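{- If $M\in\mathcal E_3$ and $\chi(M)\ge3$, then $M$ has an induced $K_5$-restriction.
   Context: A simple binary matroid (here just "matroid") is a pair $M=(E,G)$, where $G$ is identified with $\mathbb F_2^n\setminus\{0\}$ and $E\subseteq G$. A flat of $G$ is a set $V\setminus\{0\}$ with $V$ a subspace, of dimension $\dim V$. The critical number $\chi(M)$ is the smallest $k\ge0$ such that $G\setminus E$ contains a flat of dimension $n-k$. $\mathcal E_3$ is the class of matroids $(E,G)$ with $|E\cap F|$ even for every flat $F$ of dimension at least $3$. $K_5$ is the matroid $(E_0,\mathbb F_2^4\setminus\{0\})$ with $E_0$ the vectors of Hamming weight $1$ or $2$. $M$ has an induced $K_5$-restriction if there is an injective linear map $\varphi:\mathbb F_2^4\setminus\{0\}\to G$ (linear on underlying spaces) with $\varphi(E_0)=E\cap\varphi(\mathbb F_2^4\setminus\{0\})$. -}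

module Defs where

open import Data.Bool using (Bool; true; false; _∧_; _xor_; not; if_then_else_)
open import Data.Nat using (ℕ; zero; suc; _≤_; _∸_; _+_; _≡ᵇ_)
open import Data.Nat.Divisibility using (_∣_)
open import Data.Vec using (Vec; []; _∷_; replicate; zipWith; foldr)
open import Data.Vec.Properties using (≡-dec)
open import Data.List using (List; []; _∷_; _++_; map; filter; length)
open import Data.Bool.ListAction using (any)
open import Data.Product using (Σ; _×_; ∃-syntax)
open import Relation.Nullary using (¬_; does)
open import Relation.Binary.PropositionalEquality using (_≡_; _≢_)
import Data.Bool as B
open import Function.Definitions using (Injective)

-- F₂^n modelled as Vec Bool n (false = 0, true = 1, xor = addition)
F2 : ℕ → Set
F2 n = Vec Bool n

0v : ∀ {n} → F2 n
0v = replicate _ false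

_⊕_ : ∀ {n} → F2 n → F2 n → F2 n
_⊕_ = zipWith _xor_

_==_ : ∀ {n} → F2 n → F2 n → Bool
x == y = does (≡-dec B._≟_ x y)

nonzero : ∀ {n} → F2 n → Bool
nonzero x = not (x == 0v)

allVecs : (n : ℕ) → List (F2 n)
allVecs zero = [] ∷ []
allVecs (suc n) = map (false ∷_) (allVecs n) ++ map (true ∷_) (allVecs n)

comb : ∀ {n d} → Vec (F2 n) d → F2 d → F2 n
comb [] [] = 0v
comb (v ∷ b) (c ∷ cs) = (if c then v else 0v) ⊕ comb b cs

Independent : ∀ {n d} → Vec (F2 n) d → Set
Independent {d = d} b = ∀ (c : F2 d) → comb b c ≡ 0v → c ≡ 0v

inSpan : ∀ {n d} → Vec (F2 n) d → F2 n → Bool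
inSpan {d = d} b x = any (λ c → comb b c == x) (allVecs d)

-- A matroid M = (E, G) with G = F₂^n \ {0}; E is given by its characteristic
-- function on F₂^n (the value at 0 is irrelevant).
Matroid : ℕ → Set
Matroid n = F2 n → Bool

-- A flat of dimension d is span(b) \ {0} for an independent family b of d vectors.
-- |E ∩ F| for the flat F = span(b) \ {0}
countInFlat : ∀ {n d} → Matroid n → Vec (F2 n) d → ℕ
countInFlat {n} E b =
  length (filter (λ x → B.T? (E x ∧ nonzero x ∧ inSpan b x)) (allVecs n))

InE3 : ∀ {n} → Matroid n → Set
InE3 {n} E = ∀ (d : ℕ) → 3 ≤ d → (b : Vec (F2 n) d) → Independent b →
             2 ∣ countInFlat E b

ComplementContainsFlat : ∀ {n} → Matroid n → ℕ → Set
ComplementContainsFlat {n} E m =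
  Σ (Vec (F2 n) m) λ b → Independent b ×
    (∀ (x : F2 n) → inSpan b x ≡ true → nonzero x ≡ true → E x ≡ false)

-- χ(M) ≥ k : every k' ≥ 0 for which G \ E contains a flat of dimension n - k'
-- (with k' ≤ n, so that n - k' is a dimension) satisfies k ≤ k'; i.e. the
-- smallest such k' is at least k.
ChiAtLeast : ∀ {n} → Matroid n → ℕ → Set
ChiAtLeast {n} E k = ∀ (k' : ℕ) → k' ≤ n → ComplementContainsFlat E (n ∸ k') → k ≤ k'

-- E₀ of K₅: vectors of Hamming weight 1 or 2 in F₂^4
weight : ∀ {m} → F2 m → ℕ
weight = foldr _ (λ b w → (if b then 1 else 0) + w) 0

inE0 : F2 4 → Bool
inE0 x = (weight x ≡ᵇ 1) B.∨ (weight x ≡ᵇ 2)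

-- Linear (over F₂: additive) maps F₂^4 → F₂^n
Linear : ∀ {n} → (F2 4 → F2 n) → Set
Linear φ = ∀ x y → φ (x ⊕ y) ≡ φ x ⊕ φ y

-- Induced K₅-restriction: injective linear φ with φ(E₀) = E ∩ φ(F₂^4 \ {0}).
-- By injectivity of φ this is: for every nonzero x ∈ F₂^4, φ x ∈ E ⇔ x ∈ E₀.
HasInducedK5 : ∀ {n} → Matroid n → Set
HasInducedK5 {n} E =
  Σ (F2 4 → F2 n) λ φ → Linear φ × Injective _≡_ _≡_ φ ×
    (∀ (x : F2 4) → nonzero x ≡ true → E (φ x) ≡ inE0 x)

{-# OPTIONS --safe #-}

-- Put q x = [x ∈ E] for x ≠ 0 and q 0 = 0. Evenness of |E ∩ F| on 3-dimensional flats F says exactly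
-- that the polar form B u v = q (u + v) + q u + q v is bilinear, i.e. q is a quadratic form, and χ(M) ≥ 3
-- says that q vanishes on no flat of codimension ≤ 2 (so n ≥ 3, and n = 3 is excluded by a parity count).
-- Each of the following steps, if it failed, would exhibit such a singular flat: a vector a with q a = 1
-- and B a ≠ 0; an anisotropic pair a₁, a₂ (q a₁ = q a₂ = B a₁ a₂ = 1); a hyperbolic pair w, w′ in
-- a₁⊥ ∩ a₂⊥ (q w = q w′ = 0, B w w′ = 1). Then a₁, a₂, a₁ + a₂ + w, a₁ + a₂ + w′ have q = 1 and pairwise
-- B = 1, so q (Σ xᵢ cᵢ) = (|x| choose 1) + (|x| choose 2) mod 2, which is 1 exactly when |x| ∈ {1, 2}:
-- x ↦ Σ xᵢ cᵢ is an induced K₅-restriction.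

module Submission where

open import Defs
open import Data.Bool using (Bool; true; false; _∧_; _∨_; _xor_; not; if_then_else_; T?)
open import Data.Bool.Properties
  using (∧-assoc; xor-assoc; xor-comm; xor-identityˡ; xor-identityʳ; xor-same; not-involutive;
         ¬-not; not-¬; T-≡)
  renaming (_≟_ to _≟ᵇ_)
open import Data.Bool.ListAction using (any)
open import Data.Bool.Solver using (module xor-∧-Solver)
open import Data.Empty using (⊥; ⊥-elim)
import Data.List as List
open import Data.List using (List; length; filter)
open import Data.List.Membership.Propositional using (_∈_)
open import Data.List.Membership.Propositional.Properties using (∈-map⁺; ∈-map⁻; ∈-++⁺ˡ; ∈-++⁺ʳ)
import Data.List.Relation.Unary.All as All
open import Data.List.Relation.Unary.All using (All; []; _∷_)
open import Data.List.Relation.Unary.AllPairs using ([]; _∷_)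
open import Data.List.Relation.Unary.Any using (here; there; satisfied)
open import Data.List.Relation.Unary.Any.Properties using (any⁻)
open import Data.List.Relation.Unary.Unique.Propositional using (Unique)
import Data.List.Relation.Unary.Unique.Propositional.Properties as Unique
open import Data.Nat using (ℕ; zero; suc; _+_; _*_; _∸_; _≤_; _<_; z≤n; s≤s)
open import Data.Nat.Divisibility using (_∣_; divides)
open import Data.Nat.Properties using (≤-refl; <⇒≱; n∸n≡0)
open import Data.Product using (∃; _×_; _,_; proj₁; proj₂)
open import Data.Sum using (inj₁; inj₂)
open import Data.Vec using (Vec; []; _∷_; map)
open import Data.Vec.Properties
  using (≡-dec; ∷-injective; zipWith-assoc; zipWith-comm; zipWith-identityˡ; zipWith-identityʳ)
import Data.Vec.Relation.Unary.All as Vec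
open import Data.Vec.Relation.Unary.All using ([]; _∷_)
open import Data.Vec.Relation.Unary.AllPairs using (AllPairs; []; _∷_)
open import Function using (_∘_)
open import Function.Bundles using (Equivalence)
open import Relation.Binary.PropositionalEquality
open import Relation.Nullary using (¬_; Dec; yes; no; contradiction)
open import Relation.Nullary.Decidable
  using (map′; _×-dec_; _⊎-dec_; _→-dec_; ¬?; from-yes; dec-true; dec-false; decidable-stable)
open import Relation.Unary using (Decidable)

private
  variable
    n d : ℕ

-- The vector space F₂ⁿ

⊕-assoc : (x y z : F2 n) → (x ⊕ y) ⊕ z ≡ x ⊕ (y ⊕ z)
⊕-assoc = zipWith-assoc xor-assoc

⊕-comm : (x y : F2 n) → x ⊕ y ≡ y ⊕ x
⊕-comm = zipWith-comm xor-comm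

⊕-identityˡ : (x : F2 n) → 0v ⊕ x ≡ x
⊕-identityˡ = zipWith-identityˡ xor-identityˡ

⊕-identityʳ : (x : F2 n) → x ⊕ 0v ≡ x
⊕-identityʳ = zipWith-identityʳ xor-identityʳ

⊕-self : (x : F2 n) → x ⊕ x ≡ 0v
⊕-self []      = refl
⊕-self (a ∷ x) = cong₂ _∷_ (xor-same a) (⊕-self x)

⊕-cancelˡ : (x y : F2 n) → x ⊕ (x ⊕ y) ≡ y
⊕-cancelˡ x y = begin
  x ⊕ (x ⊕ y) ≡⟨ ⊕-assoc x x y ⟨
  (x ⊕ x) ⊕ y ≡⟨ cong (_⊕ y) (⊕-self x) ⟩
  0v ⊕ y      ≡⟨ ⊕-identityˡ y ⟩
  y           ∎
  where open ≡-Reasoning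

⊕≡0⇒≡ : (x y : F2 n) → x ⊕ y ≡ 0v → x ≡ y
⊕≡0⇒≡ x y x⊕y≡0 = begin
  x           ≡⟨ ⊕-identityʳ x ⟨
  x ⊕ 0v      ≡⟨ cong (x ⊕_) x⊕y≡0 ⟨
  x ⊕ (x ⊕ y) ≡⟨ ⊕-cancelˡ x y ⟩
  y           ∎
  where open ≡-Reasoning

⊕-interchange : (a b c e : F2 n) → (a ⊕ b) ⊕ (c ⊕ e) ≡ (a ⊕ c) ⊕ (b ⊕ e)
⊕-interchange a b c e = begin
  (a ⊕ b) ⊕ (c ⊕ e) ≡⟨ ⊕-assoc a b (c ⊕ e) ⟩
  a ⊕ (b ⊕ (c ⊕ e)) ≡⟨ cong (a ⊕_) (⊕-assoc b c e) ⟨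
  a ⊕ ((b ⊕ c) ⊕ e) ≡⟨ cong (λ t → a ⊕ (t ⊕ e)) (⊕-comm b c) ⟩
  a ⊕ ((c ⊕ b) ⊕ e) ≡⟨ cong (a ⊕_) (⊕-assoc c b e) ⟩
  a ⊕ (c ⊕ (b ⊕ e)) ≡⟨ ⊕-assoc a c (b ⊕ e) ⟨
  (a ⊕ c) ⊕ (b ⊕ e) ∎
  where open ≡-Reasoning

_≟_ : (x y : F2 n) → Dec (x ≡ y)
_≟_ = ≡-dec _≟ᵇ_

==⇒≡ : {x y : F2 n} → (x == y) ≡ true → x ≡ y
==⇒≡ {x = x} {y} x==y with x ≟ y
... | yes x≡y = x≡y

==-refl : (x : F2 n) → (x == x) ≡ true
==-refl x = dec-true (x ≟ x) refl

nonzero-0v : nonzero (0v {n}) ≡ false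
nonzero-0v {n} = cong not (==-refl (0v {n}))

nonzero⇒≢0v : {x : F2 n} → nonzero x ≡ true → x ≢ 0v
nonzero⇒≢0v {n} nz refl = contradiction (trans (sym nz) (nonzero-0v {n})) λ ()

≢0v⇒nonzero : {x : F2 n} → x ≢ 0v → nonzero x ≡ true
≢0v⇒nonzero {x = x} x≢0 = cong not (dec-false (x ≟ 0v) x≢0)

∃? : {P : F2 n → Set} → Decidable P → Dec (∃ P)
∃? {zero}  P? = map′ ([] ,_) (λ { ([] , p) → p }) (P? [])
∃? {suc n} P? = map′ from to (∃? (P? ∘ (false ∷_)) ⊎-dec ∃? (P? ∘ (true ∷_)))
  where
  from : _ → ∃ _
  from (inj₁ (x , p)) = false ∷ x , p
  from (inj₂ (x , p)) = true ∷ x , p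
  to : ∃ _ → _
  to (false ∷ x , p) = inj₁ (x , p)
  to (true ∷ x , p)  = inj₂ (x , p)

∀? : {P : F2 n → Set} → Decidable P → Dec (∀ x → P x)
∀? {zero}  P? = map′ (λ { p [] → p }) (λ p → p []) (P? [])
∀? {suc n} P? = map′ from (λ p → p ∘ (false ∷_) , p ∘ (true ∷_))
                     (∀? (P? ∘ (false ∷_)) ×-dec ∀? (P? ∘ (true ∷_)))
  where
  from : _ → ∀ x → _
  from (p , _) (false ∷ x) = p x
  from (_ , p) (true ∷ x)  = p x

-- With this, comb (v ∷ b) (a ∷ c) is definitionally (a · v) ⊕ comb b c.
_·_ : Bool → F2 n → F2 n
a · v = if a then v else 0v

·-xor : ∀ a b (v : F2 n) → (a xor b) · v ≡ (a · v) ⊕ (b · v)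
·-xor true  true  v = sym (⊕-self v)
·-xor true  false v = sym (⊕-identityʳ v)
·-xor false b     v = sym (⊕-identityˡ (b · v))

·-∧ : ∀ a b (v : F2 n) → a · (b · v) ≡ (a ∧ b) · v
·-∧ true  b v = refl
·-∧ false b v = refl

·-⊕ : ∀ a (u v : F2 n) → a · (u ⊕ v) ≡ (a · u) ⊕ (a · v)
·-⊕ true  u v = refl
·-⊕ false u v = sym (⊕-identityˡ 0v)

comb-0v : (b : Vec (F2 n) d) → comb b 0v ≡ 0v
comb-0v []      = refl
comb-0v (v ∷ b) = trans (⊕-identityˡ _) (comb-0v b)

comb-⊕ : (b : Vec (F2 n) d) (c c′ : F2 d) → comb b (c ⊕ c′) ≡ comb b c ⊕ comb b c′
comb-⊕ []      []      []        = sym (⊕-identityˡ 0v)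
comb-⊕ (v ∷ b) (x ∷ c) (y ∷ c′) = begin
  ((x xor y) · v) ⊕ comb b (c ⊕ c′)
    ≡⟨ cong₂ _⊕_ (·-xor x y v) (comb-⊕ b c c′) ⟩
  ((x · v) ⊕ (y · v)) ⊕ (comb b c ⊕ comb b c′)
    ≡⟨ ⊕-interchange (x · v) (y · v) (comb b c) (comb b c′) ⟩
  ((x · v) ⊕ comb b c) ⊕ ((y · v) ⊕ comb b c′) ∎
  where open ≡-Reasoning

comb-injective : (b : Vec (F2 n) d) → Independent b →
                 ∀ {c c′} → comb b c ≡ comb b c′ → c ≡ c′
comb-injective b ind {c} {c′} eq = ⊕≡0⇒≡ c c′ (ind (c ⊕ c′) (begin
  comb b (c ⊕ c′)        ≡⟨ comb-⊕ b c c′ ⟩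
  comb b c ⊕ comb b c′   ≡⟨ cong (_⊕ comb b c′) eq ⟩
  comb b c′ ⊕ comb b c′  ≡⟨ ⊕-self (comb b c′) ⟩
  0v                     ∎))
  where open ≡-Reasoning

∷≡0v : ∀ {a} {c : F2 d} → a ∷ c ≡ 0v → a ≡ false × c ≡ 0v
∷≡0v refl = refl , refl

independent-tail : ∀ {v} {b : Vec (F2 n) d} → Independent (v ∷ b) → Independent b
independent-tail ind c bc≡0 = proj₂ (∷≡0v (ind (false ∷ c) (trans (⊕-identityˡ _) bc≡0)))

standardBasis : ∀ n → Vec (F2 n) n
standardBasis zero    = []
standardBasis (suc n) = (true ∷ 0v) ∷ map (false ∷_) (standardBasis n)

comb-map-false∷ : (b : Vec (F2 n) d) (c : F2 d) → comb (map (false ∷_) b) c ≡ false ∷ comb b c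
comb-map-false∷ []      []      = refl
comb-map-false∷ (v ∷ b) (a ∷ c) = begin
  (a · (false ∷ v)) ⊕ comb (map (false ∷_) b) c ≡⟨ cong ((a · (false ∷ v)) ⊕_) (comb-map-false∷ b c) ⟩
  (a · (false ∷ v)) ⊕ (false ∷ comb b c)         ≡⟨ lemma a ⟩
  false ∷ ((a · v) ⊕ comb b c)                   ∎
  where
  open ≡-Reasoning
  lemma : ∀ a → (a · (false ∷ v)) ⊕ (false ∷ comb b c) ≡ false ∷ ((a · v) ⊕ comb b c)
  lemma true  = refl
  lemma false = refl

comb-standardBasis : (c : F2 n) → comb (standardBasis n) c ≡ c
comb-standardBasis []      = refl
comb-standardBasis (a ∷ c) = begin
  (a · (true ∷ 0v)) ⊕ comb (map (false ∷_) (standardBasis _)) c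
    ≡⟨ cong ((a · (true ∷ 0v)) ⊕_) (comb-map-false∷ (standardBasis _) c) ⟩
  (a · (true ∷ 0v)) ⊕ (false ∷ comb (standardBasis _) c)
    ≡⟨ lemma a ⟩
  a ∷ comb (standardBasis _) c
    ≡⟨ cong (a ∷_) (comb-standardBasis c) ⟩
  a ∷ c ∎
  where
  open ≡-Reasoning
  lemma : ∀ a → (a · (true ∷ 0v)) ⊕ (false ∷ comb (standardBasis _) c) ≡ a ∷ comb (standardBasis _) c
  lemma true  = cong (true ∷_) (⊕-identityˡ _)
  lemma false = cong (false ∷_) (⊕-identityˡ _)

standardBasis-independent : Independent (standardBasis n)
standardBasis-independent c eq = trans (sym (comb-standardBasis c)) eq

-- Spans and kernels of functionals

Span : Vec (F2 n) d → F2 n → Set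
Span b x = ∃ λ c → comb b c ≡ x

span-0v : (b : Vec (F2 n) d) → Span b 0v
span-0v b = 0v , comb-0v b

span-head : (v : F2 n) (b : Vec (F2 n) d) → Span (v ∷ b) v
span-head v b = true ∷ 0v , trans (cong (v ⊕_) (comb-0v b)) (⊕-identityʳ v)

span-tail : (v : F2 n) {b : Vec (F2 n) d} {x : F2 n} → Span b x → Span (v ∷ b) x
span-tail v (c , eq) = false ∷ c , trans (⊕-identityˡ _) eq

span-⊕ : (b : Vec (F2 n) d) {x y : F2 n} → Span b x → Span b y → Span b (x ⊕ y)
span-⊕ b (c , refl) (c′ , refl) = c ⊕ c′ , comb-⊕ b c c′

span-· : (b : Vec (F2 n) d) (a : Bool) {x : F2 n} → Span b x → Span b (a · x)
span-· b true  s = s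
span-· b false s = span-0v b

Additive : (F2 n → Bool) → Set
Additive f = ∀ x y → f (x ⊕ y) ≡ f x xor f y

LinearOn : Vec (F2 n) d → (F2 n → Bool) → Set
LinearOn b f = ∀ {x y} → Span b x → Span b y → f (x ⊕ y) ≡ f x xor f y

VanishesOn : (F2 n → Bool) → Vec (F2 n) d → Set
VanishesOn f b = ∀ c → f (comb b c) ≡ false

Additive⇒LinearOn : (f : F2 n → Bool) → Additive f → (b : Vec (F2 n) d) → LinearOn b f
Additive⇒LinearOn f additive b {x} {y} _ _ = additive x y

module _ (f : F2 n → Bool) where

  LinearOn-0v : (b : Vec (F2 n) d) → LinearOn b f → f 0v ≡ false
  LinearOn-0v b lin = begin
    f 0v             ≡⟨ cong f (⊕-self 0v) ⟨
    f (0v ⊕ 0v)      ≡⟨ lin (span-0v b) (span-0v b) ⟩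
    f 0v xor f 0v    ≡⟨ xor-same (f 0v) ⟩
    false            ∎
    where open ≡-Reasoning

  LinearOn-tail : ∀ {v} {b : Vec (F2 n) d} → LinearOn (v ∷ b) f → LinearOn b f
  LinearOn-tail {v = v} lin sx sy = lin (span-tail v sx) (span-tail v sy)

  LinearOn-comb-∷ : ∀ {v} {b : Vec (F2 n) d} → LinearOn (v ∷ b) f →
                    ∀ a c → f (comb (v ∷ b) (a ∷ c)) ≡ (a ∧ f v) xor f (comb b c)
  LinearOn-comb-∷ {v = v} {b} lin a c = begin
    f ((a · v) ⊕ comb b c)           ≡⟨ lin (span-· (v ∷ b) a (span-head v b)) (span-tail v (c , refl)) ⟩
    f (a · v) xor f (comb b c)       ≡⟨ cong (_xor f (comb b c)) (scale a) ⟩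
    (a ∧ f v) xor f (comb b c)       ∎
    where
    open ≡-Reasoning
    scale : ∀ a → f (a · v) ≡ a ∧ f v
    scale true  = refl
    scale false = LinearOn-0v (v ∷ b) lin

  shear : F2 n → F2 n → F2 n
  shear b₀ v = v ⊕ (f v · b₀)

  comb-map-shear : (b₀ : F2 n) (b : Vec (F2 n) d) → LinearOn b f →
                   ∀ c → comb (map (shear b₀) b) c ≡ comb b c ⊕ (f (comb b c) · b₀)
  comb-map-shear b₀ []      lin [] = begin
    0v                 ≡⟨ ⊕-self 0v ⟨
    0v ⊕ 0v            ≡⟨ cong (λ t → 0v ⊕ (t · b₀)) (LinearOn-0v [] lin) ⟨
    0v ⊕ (f 0v · b₀)   ∎
    where open ≡-Reasoning
  comb-map-shear b₀ (v ∷ b) lin (a ∷ c) = begin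
    (a · (v ⊕ (f v · b₀))) ⊕ comb (map (shear b₀) b) c
      ≡⟨ cong₂ _⊕_ (trans (·-⊕ a v _) (cong ((a · v) ⊕_) (·-∧ a (f v) b₀)))
                   (comb-map-shear b₀ b (LinearOn-tail lin) c) ⟩
    ((a · v) ⊕ ((a ∧ f v) · b₀)) ⊕ (comb b c ⊕ (f (comb b c) · b₀))
      ≡⟨ ⊕-interchange (a · v) _ (comb b c) _ ⟩
    ((a · v) ⊕ comb b c) ⊕ (((a ∧ f v) · b₀) ⊕ (f (comb b c) · b₀))
      ≡⟨ cong (((a · v) ⊕ comb b c) ⊕_) (·-xor (a ∧ f v) (f (comb b c)) b₀) ⟨
    ((a · v) ⊕ comb b c) ⊕ (((a ∧ f v) xor f (comb b c)) · b₀)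
      ≡⟨ cong (λ t → ((a · v) ⊕ comb b c) ⊕ (t · b₀)) (LinearOn-comb-∷ lin a c) ⟨
    ((a · v) ⊕ comb b c) ⊕ (f ((a · v) ⊕ comb b c) · b₀) ∎
    where open ≡-Reasoning

  -- A basis of a hyperplane of span b inside ker f: pivot on b₀ if f b₀ = 1, otherwise keep b₀.
  kernelBasis : Vec (F2 n) (suc d) → Vec (F2 n) d
  kernelBasis (b₀ ∷ b) with f b₀
  ... | true = map (shear b₀) b
  kernelBasis (b₀ ∷ [])     | false = []
  kernelBasis (b₀ ∷ b₁ ∷ b) | false = b₀ ∷ kernelBasis (b₁ ∷ b)

  kernelBasis-span : (b : Vec (F2 n) (suc d)) → LinearOn b f →
                     ∀ c → Span b (comb (kernelBasis b) c)
  kernelBasis-span (b₀ ∷ b) lin c with f b₀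
  ... | true = subst (Span (b₀ ∷ b)) (sym (comb-map-shear b₀ b (LinearOn-tail lin) c))
                 (span-⊕ (b₀ ∷ b) (span-tail b₀ (c , refl)) (span-· (b₀ ∷ b) _ (span-head b₀ b)))
  kernelBasis-span (b₀ ∷ [])     lin []      | false = span-0v (b₀ ∷ [])
  kernelBasis-span (b₀ ∷ b₁ ∷ b) lin (a ∷ c) | false =
    span-⊕ (b₀ ∷ b₁ ∷ b) (span-· (b₀ ∷ b₁ ∷ b) a (span-head b₀ (b₁ ∷ b)))
           (span-tail b₀ (kernelBasis-span (b₁ ∷ b) (LinearOn-tail lin) c))

  kernelBasis-vanishes : (b : Vec (F2 n) (suc d)) → LinearOn b f → VanishesOn f (kernelBasis b)
  kernelBasis-vanishes (b₀ ∷ b) lin c with f b₀ in fb₀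
  ... | true = begin
    f (comb (map (shear b₀) b) c)                   ≡⟨ cong f (comb-map-shear b₀ b (LinearOn-tail lin) c) ⟩
    f (comb b c ⊕ (f (comb b c) · b₀))              ≡⟨ cong f (⊕-comm _ _) ⟩
    f (comb (b₀ ∷ b) (f (comb b c) ∷ c))            ≡⟨ LinearOn-comb-∷ lin _ c ⟩
    (f (comb b c) ∧ f b₀) xor f (comb b c)          ≡⟨ cong (λ t → (f (comb b c) ∧ t) xor f (comb b c)) fb₀ ⟩
    (f (comb b c) ∧ true) xor f (comb b c)
      ≡⟨ solve 1 (λ x → (x :* con true) :+ x := con false) refl (f (comb b c)) ⟩
    false                                           ∎
    where
    open ≡-Reasoning
    open xor-∧-Solver
  kernelBasis-vanishes (b₀ ∷ [])     lin []      | false = LinearOn-0v (b₀ ∷ []) lin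
  kernelBasis-vanishes (b₀ ∷ b₁ ∷ b) lin (a ∷ c) | false = begin
    f ((a · b₀) ⊕ comb (kernelBasis (b₁ ∷ b)) c)
      ≡⟨ lin (span-· (b₀ ∷ b₁ ∷ b) a (span-head b₀ (b₁ ∷ b)))
             (span-tail b₀ (kernelBasis-span (b₁ ∷ b) (LinearOn-tail lin) c)) ⟩
    f (a · b₀) xor f (comb (kernelBasis (b₁ ∷ b)) c)
      ≡⟨ cong₂ _xor_ (scale a) (kernelBasis-vanishes (b₁ ∷ b) (LinearOn-tail lin) c) ⟩
    false ∎
    where
    open ≡-Reasoning
    scale : ∀ a → f (a · b₀) ≡ false
    scale true  = fb₀
    scale false = LinearOn-0v (b₀ ∷ b₁ ∷ b) lin

  kernelBasis-independent : (b : Vec (F2 n) (suc d)) → LinearOn b f →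
                            Independent b → Independent (kernelBasis b)
  kernelBasis-independent (b₀ ∷ b) lin ind c eq with f b₀
  ... | true = proj₂ (∷≡0v (ind (f (comb b c) ∷ c) (begin
    (f (comb b c) · b₀) ⊕ comb b c        ≡⟨ ⊕-comm _ _ ⟩
    comb b c ⊕ (f (comb b c) · b₀)        ≡⟨ comb-map-shear b₀ b (LinearOn-tail lin) c ⟨
    comb (map (shear b₀) b) c             ≡⟨ eq ⟩
    0v                                    ∎)))
    where open ≡-Reasoning
  kernelBasis-independent (b₀ ∷ [])     lin ind []      eq | false = refl
  kernelBasis-independent (b₀ ∷ b₁ ∷ b) lin ind (a ∷ c) eq | false
    with kernelBasis-span (b₁ ∷ b) (LinearOn-tail lin) c
  ... | c′ , c′≡c with ∷≡0v (ind (a ∷ c′) (trans (cong ((a · b₀) ⊕_) c′≡c) eq))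
  ... | refl , refl = cong (false ∷_)
    (kernelBasis-independent (b₁ ∷ b) (LinearOn-tail lin) (independent-tail ind) c
      (trans (sym c′≡c) (comb-0v (b₁ ∷ b))))

  VanishesOn-kernelBasis : (g : F2 n → Bool) (b : Vec (F2 n) (suc d)) → LinearOn b f →
                           VanishesOn g b → VanishesOn g (kernelBasis b)
  VanishesOn-kernelBasis g b lin vanishes c with kernelBasis-span b lin c
  ... | c′ , eq = trans (cong g (sym eq)) (vanishes c′)

Additive-0v : {f : F2 n → Bool} → Additive f → f 0v ≡ false
Additive-0v {f = f} additive = LinearOn-0v f [] (Additive⇒LinearOn f additive [])

independent-∷ : (f : F2 n → Bool) → Additive f → {y : F2 n} {b : Vec (F2 n) d} →
                f y ≡ true → VanishesOn f b → Independent b → Independent (y ∷ b)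
independent-∷ f additive {y} {b} fy vanishes ind (a ∷ c) eq =
  cong₂ _∷_ a≡false (ind c (trans (sym (⊕-identityˡ _)) (subst (λ t → (t · y) ⊕ comb b c ≡ 0v) a≡false eq)))
  where
  f-comb : ∀ a → f ((a · y) ⊕ comb b c) ≡ a
  f-comb true  = trans (additive y (comb b c)) (cong₂ _xor_ fy (vanishes c))
  f-comb false = trans (cong f (⊕-identityˡ _)) (vanishes c)
  a≡false : a ≡ false
  a≡false = trans (sym (f-comb a)) (trans (cong f eq) (Additive-0v {f = f} additive))

VanishesOn-∷ : (f : F2 n → Bool) → Additive f → {y : F2 n} {b : Vec (F2 n) d} →
               f y ≡ false → VanishesOn f b → VanishesOn f (y ∷ b)
VanishesOn-∷ f additive {y} {b} fy vanishes (true ∷ c)  =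
  trans (additive y (comb b c)) (cong₂ _xor_ fy (vanishes c))
VanishesOn-∷ f additive {y} {b} fy vanishes (false ∷ c) =
  trans (cong f (⊕-identityˡ _)) (vanishes c)

module _ (f : F2 n → Bool) (additive : Additive f) where

  cut-independent : (b : Vec (F2 n) (suc d)) → Independent b → Independent (kernelBasis f b)
  cut-independent b = kernelBasis-independent f b (Additive⇒LinearOn f additive b)

  cut-vanishes : (b : Vec (F2 n) (suc d)) → VanishesOn f (kernelBasis f b)
  cut-vanishes b = kernelBasis-vanishes f b (Additive⇒LinearOn f additive b)

  cut-preserves : (g : F2 n → Bool) (b : Vec (F2 n) (suc d)) → VanishesOn g b → VanishesOn g (kernelBasis f b)
  cut-preserves g b = VanishesOn-kernelBasis f g b (Additive⇒LinearOn f additive b)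

-- Parities

isOdd : ℕ → Bool
isOdd zero    = false
isOdd (suc k) = not (isOdd k)

2∣⇒isOdd≡false : ∀ {k} → 2 ∣ k → isOdd k ≡ false
2∣⇒isOdd≡false (divides q refl) = go q
  where
  go : ∀ q → isOdd (q * 2) ≡ false
  go zero    = refl
  go (suc q) = trans (not-involutive _) (go q)

⨁ : {A : Set} → (A → Bool) → List A → Bool
⨁ P List.[]       = false
⨁ P (x List.∷ xs) = P x xor ⨁ P xs

module _ {A : Set} where

  isOdd-count : (P : A → Bool) (xs : List A) →
                isOdd (length (filter (λ x → T? (P x)) xs)) ≡ ⨁ P xs
  isOdd-count P List.[]       = refl
  isOdd-count P (x List.∷ xs) with P x
  ... | true  = cong not (isOdd-count P xs)
  ... | false = isOdd-count P xs

  ⨁-cong : {P Q : A → Bool} → (∀ x → P x ≡ Q x) → ∀ xs → ⨁ P xs ≡ ⨁ Q xs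
  ⨁-cong P≗Q List.[]       = refl
  ⨁-cong P≗Q (x List.∷ xs) = cong₂ _xor_ (P≗Q x) (⨁-cong P≗Q xs)

  ⨁-xor : (P Q : A → Bool) (xs : List A) → ⨁ (λ x → P x xor Q x) xs ≡ ⨁ P xs xor ⨁ Q xs
  ⨁-xor P Q List.[]       = refl
  ⨁-xor P Q (x List.∷ xs) = trans (cong ((P x xor Q x) xor_) (⨁-xor P Q xs))
    (solve 4 (λ p q s t → (p :+ q) :+ (s :+ t) := (p :+ s) :+ (q :+ t)) refl (P x) (Q x) (⨁ P xs) (⨁ Q xs))
    where open xor-∧-Solver

  ⨁-false : (P : A → Bool) → (∀ x → P x ≡ false) → ∀ xs → ⨁ P xs ≡ false
  ⨁-false P P≡false List.[]       = refl
  ⨁-false P P≡false (x List.∷ xs) = cong₂ _xor_ (P≡false x) (⨁-false P P≡false xs)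

allVecs-complete : (x : F2 n) → x ∈ allVecs n
allVecs-complete []          = here refl
allVecs-complete (false ∷ x) = ∈-++⁺ˡ (∈-map⁺ (false ∷_) (allVecs-complete x))
allVecs-complete (true ∷ x)  = ∈-++⁺ʳ (List.map (false ∷_) (allVecs _)) (∈-map⁺ (true ∷_) (allVecs-complete x))

allVecs-unique : ∀ n → Unique (allVecs n)
allVecs-unique zero    = [] ∷ []
allVecs-unique (suc n) = Unique.++⁺ (Unique.map⁺ (proj₂ ∘ ∷-injective) (allVecs-unique n))
                                    (Unique.map⁺ (proj₂ ∘ ∷-injective) (allVecs-unique n))
                                    disjoint
  where
  disjoint : ∀ {v} → ¬ (v ∈ List.map (false ∷_) (allVecs n) × v ∈ List.map (true ∷_) (allVecs n))
  disjoint (v∈₀ , v∈₁) with ∈-map⁻ (false ∷_) v∈₀ | ∈-map⁻ (true ∷_) v∈₁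
  ... | _ , _ , refl | _ , _ , ()

module _ (R : F2 n → Bool) where

  ⨁-∧-≢ : (w : F2 n) {xs : List (F2 n)} → All (w ≢_) xs → ⨁ (λ x → R x ∧ (w == x)) xs ≡ false
  ⨁-∧-≢ w []                          = refl
  ⨁-∧-≢ w {x List.∷ xs} (w≢x ∷ w∉xs) = begin
    (R x ∧ (w == x)) xor ⨁ (λ x → R x ∧ (w == x)) xs
      ≡⟨ cong₂ (λ s t → (R x ∧ s) xor t) (dec-false (w ≟ x) w≢x) (⨁-∧-≢ w w∉xs) ⟩
    (R x ∧ false) xor false
      ≡⟨ solve 1 (λ r → (r :* con false) :+ con false := con false) refl (R x) ⟩
    false ∎
    where
    open ≡-Reasoning
    open xor-∧-Solver

  ⨁-∧-== : {xs : List (F2 n)} → Unique xs → ∀ {w} → w ∈ xs → ⨁ (λ x → R x ∧ (w == x)) xs ≡ R w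
  ⨁-∧-== {x List.∷ xs} (x∉xs ∷ _) {w} (here refl) = begin
    (R w ∧ (w == w)) xor ⨁ (λ x → R x ∧ (w == x)) xs
      ≡⟨ cong₂ (λ s t → (R w ∧ s) xor t) (==-refl w) (⨁-∧-≢ w x∉xs) ⟩
    (R w ∧ true) xor false
      ≡⟨ solve 1 (λ r → (r :* con true) :+ con false := r) refl (R w) ⟩
    R w ∎
    where
    open ≡-Reasoning
    open xor-∧-Solver
  ⨁-∧-== {x List.∷ xs} (x≢xs ∷ unique) {w} (there w∈xs) = begin
    (R x ∧ (w == x)) xor ⨁ (λ x → R x ∧ (w == x)) xs
      ≡⟨ cong₂ (λ s t → (R x ∧ s) xor t) (dec-false (w ≟ x) w≢x) (⨁-∧-== unique w∈xs) ⟩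
    (R x ∧ false) xor R w
      ≡⟨ solve 2 (λ r s → (r :* con false) :+ s := s) refl (R x) (R w) ⟩
    R w ∎
    where
    open ≡-Reasoning
    open xor-∧-Solver
    w≢x : w ≢ x
    w≢x refl = All.lookup x≢xs w∈xs refl

  ⨁-inSpan : (b : Vec (F2 n) d) → Independent b → {cs : List (F2 d)} → Unique cs →
             ⨁ (λ x → R x ∧ any (λ c → comb b c == x) cs) (allVecs n) ≡ ⨁ (R ∘ comb b) cs
  ⨁-inSpan b ind {List.[]} _ = ⨁-false _ (solve 1 (λ r → r :* con false := con false) refl ∘ R) (allVecs n)
    where open xor-∧-Solver
  ⨁-inSpan b ind {c List.∷ cs} (c≢cs ∷ unique) = begin
    ⨁ (λ x → R x ∧ ((comb b c == x) ∨ hit x)) (allVecs n)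
      ≡⟨ ⨁-cong split (allVecs n) ⟩
    ⨁ (λ x → (R x ∧ (comb b c == x)) xor (R x ∧ hit x)) (allVecs n)
      ≡⟨ ⨁-xor _ _ (allVecs n) ⟩
    ⨁ (λ x → R x ∧ (comb b c == x)) (allVecs n) xor ⨁ (λ x → R x ∧ hit x) (allVecs n)
      ≡⟨ cong₂ _xor_ (⨁-∧-== (allVecs-unique n) (allVecs-complete (comb b c))) (⨁-inSpan b ind unique) ⟩
    R (comb b c) xor ⨁ (R ∘ comb b) cs ∎
    where
    open ≡-Reasoning
    open xor-∧-Solver
    hit : F2 n → Bool
    hit x = any (λ c′ → comb b c′ == x) cs
    miss : ∀ {cs′} → All (c ≢_) cs′ → any (λ c′ → comb b c′ == comb b c) cs′ ≡ false
    miss []            = refl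
    miss (c≢c′ ∷ c≢cs′) = cong₂ _∨_ (dec-false (_ ≟ _) (λ eq → c≢c′ (sym (comb-injective b ind eq))))
                                   (miss c≢cs′)
    split : ∀ x → R x ∧ ((comb b c == x) ∨ hit x) ≡ (R x ∧ (comb b c == x)) xor (R x ∧ hit x)
    split x with comb b c == x in eq
    ... | true = begin
      R x ∧ true
        ≡⟨ solve 1 (λ r → r :* con true := (r :* con true) :+ (r :* con false)) refl (R x) ⟩
      (R x ∧ true) xor (R x ∧ false)
        ≡⟨ cong (λ t → (R x ∧ true) xor (R x ∧ t)) (subst (λ y → hit y ≡ false) (==⇒≡ eq) (miss c≢cs)) ⟨
      (R x ∧ true) xor (R x ∧ hit x) ∎
    ... | false = solve 2 (λ r h → r :* h := (r :* con false) :+ (r :* h)) refl (R x) (hit x)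

-- The value of a Matroid at 0v is irrelevant; member normalises it to false.
member : Matroid n → F2 n → Bool
member E x = E x ∧ nonzero x

member-0v : (E : Matroid n) → member E 0v ≡ false
member-0v {n} E = trans (cong (E 0v ∧_) (nonzero-0v {n}))
                        (solve 1 (λ e → e :* con false := con false) refl (E 0v))
  where open xor-∧-Solver

InE3⇒even-flat : (E : Matroid n) → InE3 E → 3 ≤ d → (b : Vec (F2 n) d) → Independent b →
                 ⨁ (member E ∘ comb b) (allVecs d) ≡ false
InE3⇒even-flat {n} {d} E inE3 3≤d b ind = begin
  ⨁ (member E ∘ comb b) (allVecs d)
    ≡⟨ ⨁-inSpan (member E) b ind (allVecs-unique d) ⟨
  ⨁ (λ x → member E x ∧ inSpan b x) (allVecs n)
    ≡⟨ ⨁-cong (λ x → ∧-assoc (E x) (nonzero x) (inSpan b x)) (allVecs n) ⟩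
  ⨁ (λ x → E x ∧ nonzero x ∧ inSpan b x) (allVecs n)
    ≡⟨ isOdd-count _ (allVecs n) ⟨
  isOdd (countInFlat E b)
    ≡⟨ 2∣⇒isOdd≡false (inE3 d 3≤d b ind) ⟩
  false ∎
  where open ≡-Reasoning

-- Quadratic forms

polar : (F2 n → Bool) → F2 n → F2 n → Bool
polar q u v = q (u ⊕ v) xor (q u xor q v)

Quadratic : (F2 n → Bool) → Set
Quadratic q = ∀ u → Additive (polar q u)

module _ (q : F2 n → Bool) where
  open xor-∧-Solver

  polar-comm : ∀ u v → polar q u v ≡ polar q v u
  polar-comm u v = cong₂ _xor_ (cong q (⊕-comm u v)) (xor-comm (q u) (q v))

  q-⊕ : ∀ u v → q (u ⊕ v) ≡ q u xor (q v xor polar q u v)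
  q-⊕ u v = solve 3 (λ s a b → s := a :+ (b :+ (s :+ (a :+ b)))) refl (q (u ⊕ v)) (q u) (q v)

  polar-0v : q 0v ≡ false → ∀ u → polar q u 0v ≡ false
  polar-0v q-0v u = begin
    q (u ⊕ 0v) xor (q u xor q 0v) ≡⟨ cong₂ (λ s t → q s xor (q u xor t)) (⊕-identityʳ u) q-0v ⟩
    q u xor (q u xor false)       ≡⟨ solve 1 (λ a → a :+ (a :+ con false) := con false) refl (q u) ⟩
    false                         ∎
    where open ≡-Reasoning

  polar-self : q 0v ≡ false → ∀ u → polar q u u ≡ false
  polar-self q-0v u = begin
    q (u ⊕ u) xor (q u xor q u) ≡⟨ cong₂ (λ s t → q s xor t) (⊕-self u) (xor-same (q u)) ⟩
    q 0v xor false              ≡⟨ cong (_xor false) q-0v ⟩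
    false                       ∎
    where open ≡-Reasoning

  Quadratic⇒q-0v : Quadratic q → q 0v ≡ false
  Quadratic⇒q-0v quadratic = begin
    q 0v                          ≡⟨ solve 2 (λ s a → s := (a :+ (a :+ s))) refl (q 0v) (q 0v) ⟩
    q 0v xor (q 0v xor q 0v)      ≡⟨ cong (λ t → q t xor (q 0v xor q 0v)) (⊕-identityʳ 0v) ⟨
    polar q 0v 0v                 ≡⟨ Additive-0v {f = polar q 0v} (quadratic 0v) ⟩
    false                         ∎
    where open ≡-Reasoning

  polar-translate : ∀ x v → polar q x (x ⊕ v) ≡ polar q x v
  polar-translate x v = begin
    q (x ⊕ (x ⊕ v)) xor (q x xor q (x ⊕ v)) ≡⟨ cong (λ t → q t xor (q x xor q (x ⊕ v))) (⊕-cancelˡ x v) ⟩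
    q v xor (q x xor q (x ⊕ v))
      ≡⟨ solve 3 (λ a b s → a :+ (b :+ s) := s :+ (b :+ a)) refl (q v) (q x) (q (x ⊕ v)) ⟩
    q (x ⊕ v) xor (q x xor q v)             ∎
    where open ≡-Reasoning

span₃ : (x y z : F2 n) → F2 3 → F2 n
span₃ x y z (false ∷ false ∷ false ∷ []) = 0v
span₃ x y z (false ∷ false ∷ true  ∷ []) = z
span₃ x y z (false ∷ true  ∷ false ∷ []) = y
span₃ x y z (false ∷ true  ∷ true  ∷ []) = y ⊕ z
span₃ x y z (true  ∷ false ∷ false ∷ []) = x
span₃ x y z (true  ∷ false ∷ true  ∷ []) = x ⊕ z
span₃ x y z (true  ∷ true  ∷ false ∷ []) = x ⊕ y
span₃ x y z (true  ∷ true  ∷ true  ∷ []) = x ⊕ (y ⊕ z)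

comb≡span₃ : (x y z : F2 n) (c : F2 3) → comb (x ∷ y ∷ z ∷ []) c ≡ span₃ x y z c
comb≡span₃ x y z (false ∷ false ∷ false ∷ []) = comb-0v (x ∷ y ∷ z ∷ [])
comb≡span₃ x y z (false ∷ false ∷ true  ∷ []) = trans (⊕-identityˡ _) (trans (⊕-identityˡ _) (⊕-identityʳ z))
comb≡span₃ x y z (false ∷ true  ∷ false ∷ []) = trans (⊕-identityˡ _) (trans (cong (y ⊕_) (⊕-identityˡ 0v)) (⊕-identityʳ y))
comb≡span₃ x y z (false ∷ true  ∷ true  ∷ []) = trans (⊕-identityˡ _) (cong (y ⊕_) (⊕-identityʳ z))
comb≡span₃ x y z (true  ∷ false ∷ false ∷ []) = trans (cong (x ⊕_) (comb-0v (y ∷ z ∷ []))) (⊕-identityʳ x)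
comb≡span₃ x y z (true  ∷ false ∷ true  ∷ []) = cong (x ⊕_) (trans (⊕-identityˡ _) (⊕-identityʳ z))
comb≡span₃ x y z (true  ∷ true  ∷ false ∷ []) = cong (x ⊕_) (trans (cong (y ⊕_) (⊕-identityˡ 0v)) (⊕-identityʳ y))
comb≡span₃ x y z (true  ∷ true  ∷ true  ∷ []) = cong (x ⊕_) (cong (y ⊕_) (⊕-identityʳ z))

module _ (q : F2 n → Bool) (q-0v : q 0v ≡ false) where
  open xor-∧-Solver

  -- The defect of additivity of polar q x at (y, z) is the sum of q over span {x, y, z}.
  polar-additive-flat : ∀ x y z → ⨁ (q ∘ span₃ x y z) (allVecs 3) ≡ false →
                        polar q x (y ⊕ z) ≡ polar q x y xor polar q x z
  polar-additive-flat x y z even = begin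
    polar q x (y ⊕ z)
      ≡⟨ solve 8 (λ o a b c e f g h → h :+ (e :+ c) :=
                   ((g :+ (e :+ b)) :+ (f :+ (e :+ a)))
                   :+ ((o :+ (a :+ (b :+ (c :+ (e :+ (f :+ (g :+ (h :+ con false)))))))) :+ o))
               refl (q 0v) (q z) (q y) (q (y ⊕ z)) (q x) (q (x ⊕ z)) (q (x ⊕ y)) (q (x ⊕ (y ⊕ z))) ⟩
    (polar q x y xor polar q x z) xor (⨁ (q ∘ span₃ x y z) (allVecs 3) xor q 0v)
      ≡⟨ cong₂ (λ s t → (polar q x y xor polar q x z) xor (s xor t)) even q-0v ⟩
    (polar q x y xor polar q x z) xor false
      ≡⟨ xor-identityʳ _ ⟩
    polar q x y xor polar q x z ∎
    where open ≡-Reasoning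

  polar-additive-dependent : ∀ x y z (c : F2 3) → c ≢ 0v → span₃ x y z c ≡ 0v →
                             polar q x (y ⊕ z) ≡ polar q x y xor polar q x z
  polar-additive-dependent x y z (false ∷ false ∷ false ∷ []) c≢0 _ = contradiction refl c≢0
  polar-additive-dependent x y .0v (false ∷ false ∷ true ∷ []) _ refl =
    trans (cong (polar q x) (⊕-identityʳ y))
          (sym (trans (cong (polar q x y xor_) (polar-0v q q-0v x)) (xor-identityʳ _)))
  polar-additive-dependent x .0v z (false ∷ true ∷ false ∷ []) _ refl =
    trans (cong (polar q x) (⊕-identityˡ z)) (sym (cong (_xor polar q x z) (polar-0v q q-0v x)))
  polar-additive-dependent x y z (false ∷ true ∷ true ∷ []) _ y⊕z≡0 with refl ← ⊕≡0⇒≡ y z y⊕z≡0 =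
    trans (cong (polar q x) (⊕-self y)) (trans (polar-0v q q-0v x) (sym (xor-same (polar q x y))))
  polar-additive-dependent .0v y z (true ∷ false ∷ false ∷ []) _ refl =
    trans (polar-0vˡ (y ⊕ z)) (sym (cong₂ _xor_ (polar-0vˡ y) (polar-0vˡ z)))
    where
    polar-0vˡ : ∀ v → polar q 0v v ≡ false
    polar-0vˡ v = trans (polar-comm q 0v v) (polar-0v q q-0v v)
  polar-additive-dependent x y z (true ∷ false ∷ true ∷ []) _ x⊕z≡0 with refl ← ⊕≡0⇒≡ x z x⊕z≡0 =
    trans (cong (polar q x) (⊕-comm y x))
          (trans (polar-translate q x y)
                 (sym (trans (cong (polar q x y xor_) (polar-self q q-0v x)) (xor-identityʳ _))))
  polar-additive-dependent x y z (true ∷ true ∷ false ∷ []) _ x⊕y≡0 with refl ← ⊕≡0⇒≡ x y x⊕y≡0 =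
    trans (polar-translate q x z) (sym (cong (_xor polar q x z) (polar-self q q-0v x)))
  polar-additive-dependent x y z (true ∷ true ∷ true ∷ []) _ x⊕y⊕z≡0 with refl ← ⊕≡0⇒≡ x (y ⊕ z) x⊕y⊕z≡0 = begin
    polar q (y ⊕ z) (y ⊕ z)                       ≡⟨ polar-self q q-0v (y ⊕ z) ⟩
    false                                         ≡⟨ xor-same (polar q y z) ⟨
    polar q y z xor polar q y z                   ≡⟨ cong₂ _xor_ (sym (P-y⊕z-y)) (sym (P-y⊕z-z)) ⟩
    polar q (y ⊕ z) y xor polar q (y ⊕ z) z       ∎
    where
    open ≡-Reasoning
    P-y⊕z-y : polar q (y ⊕ z) y ≡ polar q y z
    P-y⊕z-y = trans (polar-comm q (y ⊕ z) y) (polar-translate q y z)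
    P-y⊕z-z : polar q (y ⊕ z) z ≡ polar q y z
    P-y⊕z-z = begin
      polar q (y ⊕ z) z   ≡⟨ polar-comm q (y ⊕ z) z ⟩
      polar q z (y ⊕ z)   ≡⟨ cong (polar q z) (⊕-comm y z) ⟩
      polar q z (z ⊕ y)   ≡⟨ polar-translate q z y ⟩
      polar q z y         ≡⟨ polar-comm q z y ⟩
      polar q y z         ∎

InE3⇒Quadratic : (E : Matroid n) → InE3 E → Quadratic (member E)
InE3⇒Quadratic E inE3 x y z
  with ∃? (λ c → (comb (x ∷ y ∷ z ∷ []) c ≟ 0v) ×-dec ¬? (c ≟ 0v))
... | yes (c , b≡0 , c≢0) =
  polar-additive-dependent (member E) (member-0v E) x y z c c≢0 (trans (sym (comb≡span₃ x y z c)) b≡0)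
... | no none = polar-additive-flat (member E) (member-0v E) x y z (begin
  ⨁ (member E ∘ span₃ x y z) (allVecs 3)
    ≡⟨ ⨁-cong (cong (member E) ∘ comb≡span₃ x y z) (allVecs 3) ⟨
  ⨁ (member E ∘ comb (x ∷ y ∷ z ∷ [])) (allVecs 3)
    ≡⟨ InE3⇒even-flat E inE3 ≤-refl (x ∷ y ∷ z ∷ []) independent ⟩
  false ∎)
  where
  open ≡-Reasoning
  independent : Independent (x ∷ y ∷ z ∷ [])
  independent c b≡0 = decidable-stable (c ≟ 0v) (λ c≢0 → none (c , b≡0 , c≢0))

-- Cliques and K₅

-- triangleParity w is the parity of w (w + 1) / 2 = (w choose 1) + (w choose 2).
triangleParity : ℕ → Bool
triangleParity zero    = false
triangleParity (suc w) = not (triangleParity w xor isOdd w)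

K5-form : (x : F2 4) → triangleParity (weight x) ≡ inE0 x
K5-form = from-yes (∀? (λ x → triangleParity (weight x) ≟ᵇ inE0 x))

inE0-aperiodic : (x : F2 4) → (∀ y → inE0 (x ⊕ y) ≡ inE0 y) → x ≡ 0v
inE0-aperiodic = from-yes (∀? (λ x → ∀? (λ y → inE0 (x ⊕ y) ≟ᵇ inE0 y) →-dec (x ≟ 0v)))

module QuadraticForm {n} (q : F2 n → Bool) (quadratic : Quadratic q) where
  open xor-∧-Solver

  B : F2 n → F2 n → Bool
  B = polar q

  q-0v : q 0v ≡ false
  q-0v = Quadratic⇒q-0v q quadratic

  B-comm : ∀ u v → B u v ≡ B v u
  B-comm = polar-comm q

  B-self : ∀ u → B u u ≡ false
  B-self = polar-self q q-0v

  B-additiveˡ : ∀ u v w → B (u ⊕ v) w ≡ B u w xor B v w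
  B-additiveˡ u v w = begin
    B (u ⊕ v) w       ≡⟨ B-comm (u ⊕ v) w ⟩
    B w (u ⊕ v)       ≡⟨ quadratic w u v ⟩
    B w u xor B w v   ≡⟨ cong₂ _xor_ (B-comm w u) (B-comm w v) ⟩
    B u w xor B v w   ∎
    where open ≡-Reasoning

  q-·⊕ : ∀ a v w → q ((a · v) ⊕ w) ≡ (a ∧ q v) xor (q w xor (a ∧ B v w))
  q-·⊕ true  v w = q-⊕ q v w
  q-·⊕ false v w = trans (cong q (⊕-identityˡ w)) (sym (xor-identityʳ (q w)))

  B-·⊕ : ∀ u a v w → B u ((a · v) ⊕ w) ≡ (a ∧ B u v) xor B u w
  B-·⊕ u true  v w = quadratic u v w
  B-·⊕ u false v w = cong (B u) (⊕-identityˡ w)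

  q-⊕-eval : ∀ u v {a b c} → q u ≡ a → q v ≡ b → B u v ≡ c → q (u ⊕ v) ≡ a xor (b xor c)
  q-⊕-eval u v refl refl refl = q-⊕ q u v

  B-⊕ˡ-eval : ∀ u v w {a b} → B u w ≡ a → B v w ≡ b → B (u ⊕ v) w ≡ a xor b
  B-⊕ˡ-eval u v w refl refl = B-additiveˡ u v w

  B-⊕ʳ-eval : ∀ u v w {a b} → B u v ≡ a → B u w ≡ b → B u (v ⊕ w) ≡ a xor b
  B-⊕ʳ-eval u v w refl refl = quadratic u v w

  Clique : Vec (F2 n) d → Set
  Clique cs = Vec.All (λ c → q c ≡ true) cs × AllPairs (λ u v → B u v ≡ true) cs

  B-comb-adjacent : ∀ {u} {cs : Vec (F2 n) d} → Vec.All (λ c → B u c ≡ true) cs →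
                    ∀ x → B u (comb cs x) ≡ isOdd (weight x)
  B-comb-adjacent {u = u} [] [] = polar-0v q q-0v u
  B-comb-adjacent {u = u} {c ∷ cs} (Buc ∷ adjacent) (a ∷ x) = begin
    B u ((a · c) ⊕ comb cs x)       ≡⟨ B-·⊕ u a c (comb cs x) ⟩
    (a ∧ B u c) xor B u (comb cs x) ≡⟨ cong₂ (λ s t → (a ∧ s) xor t) Buc (B-comb-adjacent adjacent x) ⟩
    (a ∧ true) xor isOdd (weight x) ≡⟨ step a ⟩
    isOdd (weight (a ∷ x))          ∎
    where
    open ≡-Reasoning
    step : ∀ a → (a ∧ true) xor isOdd (weight x) ≡ isOdd (weight (a ∷ x))
    step true  = refl
    step false = refl

  q-comb-clique : {cs : Vec (F2 n) d} → Clique cs → ∀ x → q (comb cs x) ≡ triangleParity (weight x)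
  q-comb-clique {cs = []} _ [] = q-0v
  q-comb-clique {cs = c ∷ cs} (qc ∷ qcs , adjacent ∷ pairs) (a ∷ x) = begin
    q ((a · c) ⊕ comb cs x)
      ≡⟨ q-·⊕ a c (comb cs x) ⟩
    (a ∧ q c) xor (q (comb cs x) xor (a ∧ B c (comb cs x)))
      ≡⟨ cong₂ (λ s t → (a ∧ s) xor t) qc
               (cong₂ (λ s t → s xor (a ∧ t)) (q-comb-clique (qcs , pairs) x) (B-comb-adjacent adjacent x)) ⟩
    (a ∧ true) xor (triangleParity (weight x) xor (a ∧ isOdd (weight x)))
      ≡⟨ step a ⟩
    triangleParity (weight (a ∷ x)) ∎
    where
    open ≡-Reasoning
    step : ∀ a → (a ∧ true) xor (triangleParity (weight x) xor (a ∧ isOdd (weight x)))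
                 ≡ triangleParity (weight (a ∷ x))
    step true  = refl
    step false = xor-identityʳ _

  singular-∷ : ∀ {y} {b : Vec (F2 n) d} → q y ≡ false → VanishesOn (B y) b → VanishesOn q b →
               VanishesOn q (y ∷ b)
  singular-∷ {y = y} {b} qy By-vanishes q-vanishes (a ∷ c) = begin
    q ((a · y) ⊕ comb b c)                                  ≡⟨ q-·⊕ a y (comb b c) ⟩
    (a ∧ q y) xor (q (comb b c) xor (a ∧ B y (comb b c)))
      ≡⟨ cong₂ (λ s t → (a ∧ s) xor t) qy (cong₂ (λ s t → s xor (a ∧ t)) (q-vanishes c) (By-vanishes c)) ⟩
    (a ∧ false) xor (false xor (a ∧ false))
      ≡⟨ solve 1 (λ a → (a :* con false) :+ (con false :+ (a :* con false)) := con false) refl a ⟩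
    false ∎
    where open ≡-Reasoning

  module _ {cs : Vec (F2 n) 4} (clique : Clique cs) where

    q-comb-K5 : ∀ x → q (comb cs x) ≡ inE0 x
    q-comb-K5 x = trans (q-comb-clique clique x) (K5-form x)

    -- A nonzero vector in the kernel of comb cs would be a period of inE0.
    comb-K5-injective : ∀ {x y} → comb cs x ≡ comb cs y → x ≡ y
    comb-K5-injective {x} {y} eq = ⊕≡0⇒≡ x y (inE0-aperiodic (x ⊕ y) periodic)
      where
      open ≡-Reasoning
      comb-x⊕y : comb cs (x ⊕ y) ≡ 0v
      comb-x⊕y = trans (comb-⊕ cs x y) (trans (cong (_⊕ comb cs y) eq) (⊕-self (comb cs y)))
      periodic : ∀ z → inE0 ((x ⊕ y) ⊕ z) ≡ inE0 z
      periodic z = begin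
        inE0 ((x ⊕ y) ⊕ z)                ≡⟨ q-comb-K5 ((x ⊕ y) ⊕ z) ⟨
        q (comb cs ((x ⊕ y) ⊕ z))         ≡⟨ cong q (comb-⊕ cs (x ⊕ y) z) ⟩
        q (comb cs (x ⊕ y) ⊕ comb cs z)   ≡⟨ cong (λ t → q (t ⊕ comb cs z)) comb-x⊕y ⟩
        q (0v ⊕ comb cs z)                ≡⟨ cong q (⊕-identityˡ (comb cs z)) ⟩
        q (comb cs z)                     ≡⟨ q-comb-K5 z ⟩
        inE0 z                            ∎

clique⇒HasInducedK5 : (E : Matroid n) (quadratic : Quadratic (member E)) {cs : Vec (F2 n) 4} →
                      QuadraticForm.Clique (member E) quadratic cs → HasInducedK5 E
clique⇒HasInducedK5 E quadratic {cs} clique =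
  comb cs , comb-⊕ cs , comb-K5-injective clique , E-comb
  where
  open QuadraticForm (member E) quadratic
  E-comb : ∀ x → nonzero x ≡ true → E (comb cs x) ≡ inE0 x
  E-comb x nz = begin
    E (comb cs x)                             ≡⟨ solve 1 (λ e → e := e :* con true) refl (E (comb cs x)) ⟩
    E (comb cs x) ∧ true                      ≡⟨ cong (E (comb cs x) ∧_) (≢0v⇒nonzero φx≢0) ⟨
    member E (comb cs x)                      ≡⟨ q-comb-K5 clique x ⟩
    inE0 x                                    ∎
    where
    open ≡-Reasoning
    open xor-∧-Solver
    φx≢0 : comb cs x ≢ 0v
    φx≢0 φx≡0 = nonzero⇒≢0v nz (comb-K5-injective clique (trans φx≡0 (sym (comb-0v cs))))

-- Finding a clique

NoSingularFlat : (F2 n → Bool) → ℕ → Set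
NoSingularFlat {n} q d = (b : Vec (F2 n) d) → Independent b → ¬ VanishesOn q b

module CliqueSearch {m} (q : F2 (4 + m) → Bool) (quadratic : Quadratic q)
                    (noSingular : NoSingularFlat q (2 + m)) where
  open QuadraticForm q quadratic
  open xor-∧-Solver

  private
    N : ℕ
    N = 4 + m

  no-singular-codim₂ : (f h : F2 N → Bool) → Additive f → Additive h →
                       (∀ x → f x ≡ false → h x ≡ false → q x ≡ false) → ⊥
  no-singular-codim₂ f h f-additive h-additive singular = noSingular b₂ independent λ c →
    singular _ (cut-preserves h h-additive f b₁ (cut-vanishes f f-additive (standardBasis N)) c)
               (cut-vanishes h h-additive b₁ c)
    where
    b₁ : Vec (F2 N) (3 + m)
    b₁ = kernelBasis f (standardBasis N)
    b₂ : Vec (F2 N) (2 + m)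
    b₂ = kernelBasis h b₁
    independent : Independent b₂
    independent = cut-independent h h-additive b₁
                    (cut-independent f f-additive (standardBasis N) standardBasis-independent)

  partner : ∃ λ a → q a ≡ true × ∃ λ y → B a y ≡ true
  partner = decidable-stable (∃? (λ a → (q a ≟ᵇ true) ×-dec ∃? (λ y → B a y ≟ᵇ true))) refute
    where
    refute : ¬ (∃ λ a → q a ≡ true × ∃ λ y → B a y ≡ true) → ⊥
    refute none = no-singular-codim₂ q q q-additive q-additive (λ x qx _ → qx)
      where
      B-anisotropic : ∀ {a} y → q a ≡ true → B a y ≡ false
      B-anisotropic y qa = ¬-not (λ Bay → none (_ , qa , y , Bay))
      B-zero : ∀ x y → B x y ≡ false
      B-zero x y with q x ≟ᵇ true | q y ≟ᵇ true
      ... | yes qx | _      = B-anisotropic y qx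
      ... | no _   | yes qy = trans (B-comm x y) (B-anisotropic x qy)
      ... | no qx  | no qy  = ¬-not λ Bxy → contradiction
        (B-⊕ˡ-eval x y y Bxy (B-self y))
        (not-¬ (B-anisotropic y (q-⊕-eval x y (¬-not qx) (¬-not qy) Bxy)))
      q-additive : Additive q
      q-additive x y = trans (q-⊕ q x y)
        (trans (cong (λ t → q x xor (q y xor t)) (B-zero x y)) (cong (q x xor_) (xor-identityʳ (q y))))

  anisotropicPair : ∃ λ a₁ → q a₁ ≡ true × ∃ λ a₂ → q a₂ ≡ true × B a₁ a₂ ≡ true
  anisotropicPair = let a , qa , y , Bay = partner in
    a , qa , decidable-stable (∃? (λ a₂ → (q a₂ ≟ᵇ true) ×-dec (B a a₂ ≟ᵇ true))) (refute a y Bay)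
    where
    refute : ∀ a y → B a y ≡ true → ¬ (∃ λ a₂ → q a₂ ≡ true × B a a₂ ≡ true) → ⊥
    refute a y Bay none = no-singular-codim₂ (B a) (B y) (quadratic a) (quadratic y) singular
      where
      isotropic : ∀ {v} → B a v ≡ true → q v ≡ false
      isotropic Bav = ¬-not (λ qv → none (_ , qv , Bav))
      singular : ∀ x → B a x ≡ false → B y x ≡ false → q x ≡ false
      singular x Bax Byx = begin
        q x                          ≡⟨ solve 1 (λ s → s := s :+ (con false :+ con false)) refl (q x) ⟩
        q x xor (false xor false)
          ≡⟨ cong₂ (λ s t → q x xor (s xor t)) (isotropic Bay) (trans (B-comm x y) Byx) ⟨
        q x xor (q y xor B x y)      ≡⟨ q-⊕ q x y ⟨
        q (x ⊕ y)                    ≡⟨ isotropic (B-⊕ʳ-eval a x y Bax Bay) ⟩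
        false                        ∎
        where open ≡-Reasoning

  module Complement {a₁ a₂ : F2 N} (q-a₁ : q a₁ ≡ true) (q-a₂ : q a₂ ≡ true) (B-a₁a₂ : B a₁ a₂ ≡ true) where

    Orth : F2 N → Set
    Orth x = B a₁ x ≡ false × B a₂ x ≡ false

    orth? : Decidable Orth
    orth? x = (B a₁ x ≟ᵇ false) ×-dec (B a₂ x ≟ᵇ false)

    Orth-⊕ : ∀ {x y} → Orth x → Orth y → Orth (x ⊕ y)
    Orth-⊕ {x} {y} (x⊥a₁ , x⊥a₂) (y⊥a₁ , y⊥a₂) = B-⊕ʳ-eval a₁ x y x⊥a₁ y⊥a₁ , B-⊕ʳ-eval a₂ x y x⊥a₂ y⊥a₂

    B-a₂a₁ : B a₂ a₁ ≡ true
    B-a₂a₁ = trans (B-comm a₂ a₁) B-a₁a₂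

    basis₁ : Vec (F2 N) (3 + m)
    basis₁ = kernelBasis (B a₁) (standardBasis N)

    basis⊥ : Vec (F2 N) (2 + m)
    basis⊥ = kernelBasis (B a₂) basis₁

    basis⊥-independent : Independent basis⊥
    basis⊥-independent = cut-independent (B a₂) (quadratic a₂) basis₁
                           (cut-independent (B a₁) (quadratic a₁) (standardBasis N) standardBasis-independent)

    basis⊥-⊥a₁ : VanishesOn (B a₁) basis⊥
    basis⊥-⊥a₁ = cut-preserves (B a₂) (quadratic a₂) (B a₁) basis₁
                   (cut-vanishes (B a₁) (quadratic a₁) (standardBasis N))

    basis⊥-⊥a₂ : VanishesOn (B a₂) basis⊥
    basis⊥-⊥a₂ = cut-vanishes (B a₂) (quadratic a₂) basis₁

    hyperbolic⇒clique : ∀ {w w′} → Orth w → Orth w′ → q w ≡ false → q w′ ≡ false → B w w′ ≡ true →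
                        Clique (a₁ ∷ a₂ ∷ (a₁ ⊕ a₂) ⊕ w ∷ (a₁ ⊕ a₂) ⊕ w′ ∷ [])
    hyperbolic⇒clique {w} {w′} w⊥ w′⊥ qw qw′ Bww′ =
      (q-a₁ ∷ q-a₂ ∷ q-shift w⊥ qw ∷ q-shift w′⊥ qw′ ∷ []) ,
      (B-a₁a₂ ∷ B-a₁-shift w⊥ ∷ B-a₁-shift w′⊥ ∷ []) ∷
      (B-a₂-shift w⊥ ∷ B-a₂-shift w′⊥ ∷ []) ∷
      (B-shift-shift ∷ []) ∷ [] ∷ []
      where
      b : F2 N
      b = a₁ ⊕ a₂
      q-b : q b ≡ true
      q-b = q-⊕-eval a₁ a₂ q-a₁ q-a₂ B-a₁a₂
      B-b : ∀ {x} → Orth x → B b x ≡ false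
      B-b {x} (x⊥a₁ , x⊥a₂) = B-⊕ˡ-eval a₁ a₂ x x⊥a₁ x⊥a₂
      q-shift : ∀ {x} → Orth x → q x ≡ false → q (b ⊕ x) ≡ true
      q-shift {x} x⊥ qx = q-⊕-eval b x q-b qx (B-b x⊥)
      B-a₁-shift : ∀ {x} → Orth x → B a₁ (b ⊕ x) ≡ true
      B-a₁-shift {x} (x⊥a₁ , _) = B-⊕ʳ-eval a₁ b x (B-⊕ʳ-eval a₁ a₁ a₂ (B-self a₁) B-a₁a₂) x⊥a₁
      B-a₂-shift : ∀ {x} → Orth x → B a₂ (b ⊕ x) ≡ true
      B-a₂-shift {x} (_ , x⊥a₂) = B-⊕ʳ-eval a₂ b x (B-⊕ʳ-eval a₂ a₁ a₂ B-a₂a₁ (B-self a₂)) x⊥a₂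
      B-shift-shift : B (b ⊕ w) (b ⊕ w′) ≡ true
      B-shift-shift = B-⊕ˡ-eval b w (b ⊕ w′)
        (B-⊕ʳ-eval b b w′ (B-self b) (B-b w′⊥))
        (B-⊕ʳ-eval w b w′ (trans (B-comm w b) (B-b w⊥)) Bww′)

    module NoHyperbolicPair
      (noHyperbolic : ∀ {w w′} → Orth w → Orth w′ → q w ≡ false → q w′ ≡ false → B w w′ ≡ false) where

      isotropic-⊥pair : ∀ {u v z} → Orth u → Orth v → q u ≡ true → q v ≡ true → B u v ≡ true →
                        Orth z → B u z ≡ false → B v z ≡ false → q z ≡ false
      isotropic-⊥pair {u} {v} {z} u⊥ v⊥ qu qv Buv z⊥ Buz Bvz = ¬-not λ qz → contradiction
        (noHyperbolic (Orth-⊕ u⊥ z⊥) (Orth-⊕ v⊥ z⊥) (q-⊕-eval u z qu qz Buz) (q-⊕-eval v z qv qz Bvz))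
        (not-¬ (B-⊕ˡ-eval u z (v ⊕ z) (B-⊕ʳ-eval u v z Buv Buz)
                                      (B-⊕ʳ-eval z v z (trans (B-comm z v) Bvz) (B-self z))))

      -- ⟨a₁, a₂⟩ and ⟨u, v⟩ are orthogonal isometric anisotropic planes, so q vanishes on the
      -- diagonal ⟨a₁ + u, a₂ + v⟩ and on its orthogonal complement inside a₁⊥ ∩ a₂⊥ ∩ u⊥ ∩ v⊥.
      no-anisotropic-pair : ∀ {u v} → Orth u → Orth v → q u ≡ true → q v ≡ true → q (u ⊕ v) ≡ true → ⊥
      no-anisotropic-pair {u} {v} u⊥@(u⊥a₁ , u⊥a₂) v⊥@(v⊥a₁ , v⊥a₂) qu qv quv =
        noSingular (a₁ ⊕ u ∷ a₂ ⊕ v ∷ basis) independent singular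
        where
        B-uv : B u v ≡ true
        B-uv = cong₂ _xor_ quv (cong₂ _xor_ qu qv)
        basis₀ : Vec (F2 N) (suc m)
        basis₀ = kernelBasis (B u) basis⊥
        basis : Vec (F2 N) m
        basis = kernelBasis (B v) basis₀
        ⊥a₁ : VanishesOn (B a₁) basis
        ⊥a₁ = cut-preserves (B v) (quadratic v) (B a₁) basis₀
                (cut-preserves (B u) (quadratic u) (B a₁) basis⊥ basis⊥-⊥a₁)
        ⊥a₂ : VanishesOn (B a₂) basis
        ⊥a₂ = cut-preserves (B v) (quadratic v) (B a₂) basis₀
                (cut-preserves (B u) (quadratic u) (B a₂) basis⊥ basis⊥-⊥a₂)
        ⊥u : VanishesOn (B u) basis
        ⊥u = cut-preserves (B v) (quadratic v) (B u) basis₀ (cut-vanishes (B u) (quadratic u) basis⊥)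
        ⊥v : VanishesOn (B v) basis
        ⊥v = cut-vanishes (B v) (quadratic v) basis₀
        independent : Independent (a₁ ⊕ u ∷ a₂ ⊕ v ∷ basis)
        independent =
          independent-∷ (B a₂) (quadratic a₂) (B-⊕ʳ-eval a₂ a₁ u B-a₂a₁ u⊥a₂)
            (VanishesOn-∷ (B a₂) (quadratic a₂) (B-⊕ʳ-eval a₂ a₂ v (B-self a₂) v⊥a₂) ⊥a₂)
            (independent-∷ (B a₁) (quadratic a₁) (B-⊕ʳ-eval a₁ a₂ v B-a₁a₂ v⊥a₁) ⊥a₁
              (cut-independent (B v) (quadratic v) basis₀
                (cut-independent (B u) (quadratic u) basis⊥ basis⊥-independent)))
        singular : VanishesOn q (a₁ ⊕ u ∷ a₂ ⊕ v ∷ basis)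
        singular =
          singular-∷ (q-⊕-eval a₁ u q-a₁ qu u⊥a₁)
            (VanishesOn-∷ (B (a₁ ⊕ u)) (quadratic (a₁ ⊕ u))
              (B-⊕ˡ-eval a₁ u (a₂ ⊕ v) (B-⊕ʳ-eval a₁ a₂ v B-a₁a₂ v⊥a₁)
                                     (B-⊕ʳ-eval u a₂ v (trans (B-comm u a₂) u⊥a₂) B-uv))
              (λ c → B-⊕ˡ-eval a₁ u (comb basis c) (⊥a₁ c) (⊥u c)))
            (singular-∷ (q-⊕-eval a₂ v q-a₂ qv v⊥a₂)
              (λ c → B-⊕ˡ-eval a₂ v (comb basis c) (⊥a₂ c) (⊥v c))
              (λ c → isotropic-⊥pair u⊥ v⊥ qu qv B-uv (⊥a₁ c , ⊥a₂ c) (⊥u c) (⊥v c)))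

      -- Here B vanishes on a₁⊥ ∩ a₂⊥, so q is linear there and ⟨a₁ + u⟩ ⊕ (a₁⊥ ∩ a₂⊥ ∩ ker q) is singular.
      module IsolatedAnisotropic {u} (u⊥ : Orth u) (qu : q u ≡ true)
                                 (isolated : ∀ {v} → Orth v → q v ≡ true → q (u ⊕ v) ≡ false) where

        B-u : ∀ {w} → Orth w → B u w ≡ false
        B-u {w} w⊥ with q w ≟ᵇ true
        ... | yes qw = cong₂ _xor_ (isolated w⊥ qw) (cong₂ _xor_ qu qw)
        ... | no ¬qw = ¬-not λ Buw → contradiction
          (noHyperbolic (Orth-⊕ u⊥ w⊥) w⊥ (q-⊕-eval u w qu (¬-not ¬qw) Buw) (¬-not ¬qw))
          (not-¬ (B-⊕ˡ-eval u w w Buw (B-self w)))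

        isotropicRepresentative : ∀ {w} → Orth w →
          ∃ λ w₀ → Orth w₀ × q w₀ ≡ false × (∀ {t} → Orth t → B w t ≡ B w₀ t)
        isotropicRepresentative {w} w⊥ with q w ≟ᵇ true
        ... | yes qw = u ⊕ w , Orth-⊕ u⊥ w⊥ , q-⊕-eval u w qu qw (B-u w⊥) ,
                       λ {t} t⊥ → sym (B-⊕ˡ-eval u w t (B-u t⊥) refl)
        ... | no ¬qw = w , w⊥ , ¬-not ¬qw , λ _ → refl

        B-Orth : ∀ {w w′} → Orth w → Orth w′ → B w w′ ≡ false
        B-Orth {w} {w′} w⊥ w′⊥ with isotropicRepresentative w⊥ | isotropicRepresentative w′⊥
        ... | w₀ , w₀⊥ , qw₀ , Bw≡Bw₀ | w₀′ , w₀′⊥ , qw₀′ , Bw′≡Bw₀′ = begin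
          B w w′     ≡⟨ Bw≡Bw₀ w′⊥ ⟩
          B w₀ w′    ≡⟨ B-comm w₀ w′ ⟩
          B w′ w₀    ≡⟨ Bw′≡Bw₀′ w₀⊥ ⟩
          B w₀′ w₀   ≡⟨ noHyperbolic w₀′⊥ w₀⊥ qw₀′ qw₀ ⟩
          false      ∎
          where open ≡-Reasoning

        q-linear : LinearOn basis⊥ q
        q-linear {x} {y} (c , refl) (c′ , refl) = begin
          q (x ⊕ y)                 ≡⟨ q-⊕ q x y ⟩
          q x xor (q y xor B x y)   ≡⟨ cong (λ t → q x xor (q y xor t)) (B-Orth x⊥ y⊥) ⟩
          q x xor (q y xor false)   ≡⟨ cong (q x xor_) (xor-identityʳ (q y)) ⟩
          q x xor q y               ∎
          where
          open ≡-Reasoning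
          x⊥ : Orth x
          x⊥ = basis⊥-⊥a₁ c , basis⊥-⊥a₂ c
          y⊥ : Orth y
          y⊥ = basis⊥-⊥a₁ c′ , basis⊥-⊥a₂ c′

        absurd : ⊥
        absurd = noSingular (a₁ ⊕ u ∷ basis) independent singular
          where
          basis : Vec (F2 N) (suc m)
          basis = kernelBasis q basis⊥
          ⊥a₁ : VanishesOn (B a₁) basis
          ⊥a₁ = VanishesOn-kernelBasis q (B a₁) basis⊥ q-linear basis⊥-⊥a₁
          ⊥a₂ : VanishesOn (B a₂) basis
          ⊥a₂ = VanishesOn-kernelBasis q (B a₂) basis⊥ q-linear basis⊥-⊥a₂
          independent : Independent (a₁ ⊕ u ∷ basis)
          independent = independent-∷ (B a₂) (quadratic a₂) (B-⊕ʳ-eval a₂ a₁ u B-a₂a₁ (proj₂ u⊥)) ⊥a₂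
                          (kernelBasis-independent q basis⊥ q-linear basis⊥-independent)
          singular : VanishesOn q (a₁ ⊕ u ∷ basis)
          singular = singular-∷ (q-⊕-eval a₁ u q-a₁ qu (proj₁ u⊥))
                       (λ c → B-⊕ˡ-eval a₁ u (comb basis c) (⊥a₁ c) (B-u (⊥a₁ c , ⊥a₂ c)))
                       (kernelBasis-vanishes q basis⊥ q-linear)

      impossible : ⊥
      impossible with ∃? (λ u → orth? u ×-dec (q u ≟ᵇ true))
      ... | no noAnisotropic = no-singular-codim₂ (B a₁) (B a₂) (quadratic a₁) (quadratic a₂)
              (λ x x⊥a₁ x⊥a₂ → ¬-not (λ qx → noAnisotropic (x , (x⊥a₁ , x⊥a₂) , qx)))
      ... | yes (u , u⊥ , qu) with ∃? (λ v → orth? v ×-dec (q v ≟ᵇ true) ×-dec (q (u ⊕ v) ≟ᵇ true))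
      ...   | yes (v , v⊥ , qv , quv) = no-anisotropic-pair u⊥ v⊥ qu qv quv
      ...   | no noPartner = IsolatedAnisotropic.absurd u⊥ qu
                               (λ v⊥ qv → ¬-not (λ quv → noPartner (_ , v⊥ , qv , quv)))

    HyperbolicPair : F2 N → F2 N → Set
    HyperbolicPair w w′ = Orth w × Orth w′ × q w ≡ false × q w′ ≡ false × B w w′ ≡ true

    hyperbolicPair? : ∀ w w′ → Dec (HyperbolicPair w w′)
    hyperbolicPair? w w′ =
      orth? w ×-dec orth? w′ ×-dec (q w ≟ᵇ false) ×-dec (q w′ ≟ᵇ false) ×-dec (B w w′ ≟ᵇ true)

    clique : ∃ λ (cs : Vec (F2 N) 4) → Clique cs
    clique =
      let _ , _ , w⊥ , w′⊥ , qw , qw′ , Bww′ = decidable-stable (∃? (λ w → ∃? (hyperbolicPair? w))) refute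
      in _ , hyperbolic⇒clique w⊥ w′⊥ qw qw′ Bww′
      where
      refute : ¬ (∃ λ w → ∃ (HyperbolicPair w)) → ⊥
      refute noPair = NoHyperbolicPair.impossible λ w⊥ w′⊥ qw qw′ →
        ¬-not (λ Bww′ → noPair (_ , _ , w⊥ , w′⊥ , qw , qw′ , Bww′))

  clique : ∃ λ (cs : Vec (F2 N) 4) → Clique cs
  clique = let _ , q-a₁ , _ , q-a₂ , B-a₁a₂ = anisotropicPair in Complement.clique q-a₁ q-a₂ B-a₁a₂

-- The critical number

singular⇒ComplementContainsFlat : (E : Matroid n) (b : Vec (F2 n) d) → Independent b →
                                  VanishesOn (member E) b → ComplementContainsFlat E d
singular⇒ComplementContainsFlat {d = d} E b ind singular = b , ind , avoids
  where
  avoids : ∀ x → inSpan b x ≡ true → nonzero x ≡ true → E x ≡ false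
  avoids x x∈ nz with satisfied (any⁻ (λ c → comb b c == x) (allVecs d) (Equivalence.from T-≡ x∈))
  ... | c , comb==x with refl ← ==⇒≡ {x = comb b c} {x} (Equivalence.to T-≡ comb==x) = begin
    E (comb b c)                        ≡⟨ solve 1 (λ e → e := e :* con true) refl (E (comb b c)) ⟩
    E (comb b c) ∧ true                 ≡⟨ cong (E (comb b c) ∧_) nz ⟨
    member E (comb b c)                 ≡⟨ singular c ⟩
    false                               ∎
    where
    open ≡-Reasoning
    open xor-∧-Solver

χ≥3⇒noSingularFlat : (E : Matroid n) → ChiAtLeast E 3 →
                     ∀ k → k ≤ n → k < 3 → NoSingularFlat (member E) (n ∸ k)
χ≥3⇒noSingularFlat E χ≥3 k k≤n k<3 b ind singular =
  <⇒≱ k<3 (χ≥3 k k≤n (singular⇒ComplementContainsFlat E b ind singular))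

χ≥3⇒3≤n : (E : Matroid n) → ChiAtLeast E 3 → 3 ≤ n
χ≥3⇒3≤n {n} E χ≥3 = χ≥3 n ≤-refl (subst (ComplementContainsFlat E) (sym (n∸n≡0 n))
  (singular⇒ComplementContainsFlat E [] (λ { [] _ → refl }) (λ { [] → member-0v E })))

noSingularLine⇒≡nonzero : {q : F2 n → Bool} → NoSingularFlat q 1 → q 0v ≡ false → ∀ x → q x ≡ nonzero x
noSingularLine⇒≡nonzero {n} {q} noSingular q-0v x with x ≟ 0v
... | yes refl = q-0v
... | no x≢0   = ¬-not (λ qx → noSingular (x ∷ []) independent (singular qx))
  where
  independent : Independent (x ∷ [])
  independent (true ∷ [])  eq = contradiction (trans (sym (⊕-identityʳ x)) eq) x≢0
  independent (false ∷ []) eq = refl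
  singular : q x ≡ false → VanishesOn q (x ∷ [])
  singular qx (true ∷ [])  = trans (cong q (⊕-identityʳ x)) qx
  singular qx (false ∷ []) = trans (cong q (⊕-identityˡ 0v)) q-0v

rank3-impossible : (E : Matroid 3) → InE3 E → ChiAtLeast E 3 → ⊥
rank3-impossible E inE3 χ≥3 = contradiction (begin
  ⨁ nonzero (allVecs 3)
    ≡⟨ ⨁-cong member≡nonzero (allVecs 3) ⟨
  ⨁ (member E ∘ comb (standardBasis 3)) (allVecs 3)
    ≡⟨ InE3⇒even-flat E inE3 ≤-refl (standardBasis 3) standardBasis-independent ⟩
  false ∎) λ ()
  where
  open ≡-Reasoning
  member≡nonzero : ∀ c → member E (comb (standardBasis 3) c) ≡ nonzero c
  member≡nonzero c = trans (cong (member E) (comb-standardBasis c))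
    (noSingularLine⇒≡nonzero (χ≥3⇒noSingularFlat E χ≥3 2 (s≤s (s≤s z≤n)) ≤-refl) (member-0v E) c)

lemma5p6 : (n : ℕ) (E : Matroid n) → InE3 E → ChiAtLeast E 3 → HasInducedK5 E
lemma5p6 0 E _ χ≥3 = contradiction (χ≥3⇒3≤n E χ≥3) λ ()
lemma5p6 1 E _ χ≥3 = contradiction (χ≥3⇒3≤n E χ≥3) λ { (s≤s ()) }
lemma5p6 2 E _ χ≥3 = contradiction (χ≥3⇒3≤n E χ≥3) λ { (s≤s (s≤s ())) }
lemma5p6 3 E inE3 χ≥3 = ⊥-elim (rank3-impossible E inE3 χ≥3)
lemma5p6 (suc (suc (suc (suc m)))) E inE3 χ≥3 = clique⇒HasInducedK5 E quadratic (proj₂ clique)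
  where
  quadratic : Quadratic (member E)
  quadratic = InE3⇒Quadratic E inE3
  open CliqueSearch (member E) quadratic (χ≥3⇒noSingularFlat E χ≥3 2 (s≤s (s≤s z≤n)) (s≤s (s≤s (s≤s z≤n))))
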